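{- Let $\mathcal{D}_I$ be the class of all finite irreflexive digraphs. (1) A downward closed class $\mathcal{C}\subseteq\mathcal{D}_I$ under the homomorphic image ordering is well quasi-ordered if and only if it is finite. (2) A class $\mathcal{C}=\mathrm{Av}(O_1,\dots,O_k)\subseteq\mathcal{D}_I$ defined by finitely many obstructions $O_1,\dots,O_k\in\mathcal{D}_I$, under either the standard or the strong homomorphic image ordering, is never well quasi-ordered.
   Context: A digraph is a finite set $D$ with a binary relation $E(D)\subseteq D\times D$; it is irreflexive if no $(x,x)$ is an edge. A homomorphism $\phi:S\to T$ maps edges to edges; it is strong if moreover every edge of $T$ between vertices of $\phi(S)$ is the image of an edge of $S$. Homomorphic image ordering: $A\preceq B$ iff there is a surjective homomorphism $B\to A$; strong version: surjective strong homomorphism. A class is downward closed if $A\preceq B\in\mathcal{C}$ implies $A\in\mathcal{C}$. $\mathrm{Av}(O_1,\dots,O_k)$ is the set of all $D\in\mathcal{D}_I$ with $O_i\not\preceq D$ for all $i$. Well quasi-ordered means: no infinite strictly decreasing sequence and no infinite antichain. -}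

module Defs where

open import Data.Nat using (ℕ; suc)
open import Data.Fin using (Fin)
open import Data.Bool using (Bool; T)
open import Data.Product using (Σ; ∃; ∃-syntax; _×_; _,_)
open import Data.List using (List)
open import Data.List.Relation.Unary.Any using (Any)
open import Relation.Nullary using (¬_)
open import Relation.Binary.PropositionalEquality using (_≡_; _≢_)

record Digraph : Set where
  constructor mkDigraph
  field
    size : ℕ
    E    : Fin size → Fin size → Bool
open Digraph public

Edge : (D : Digraph) → Fin (size D) → Fin (size D) → Set
Edge D x y = T (E D x y)

Irreflexive : Digraph → Set
Irreflexive D = ∀ x → ¬ Edge D x x

IsHom : (S T : Digraph) → (Fin (size S) → Fin (size T)) → Set
IsHom S T φ = ∀ x y → Edge S x y → Edge T (φ x) (φ y)

IsStrong : (S T : Digraph) → (Fin (size S) → Fin (size T)) → Set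
IsStrong S T φ = ∀ u v → (∃[ x ] φ x ≡ u) → (∃[ y ] φ y ≡ v) → Edge T u v →
  ∃[ x ] ∃[ y ] (φ x ≡ u × φ y ≡ v × Edge S x y)

IsSurjective : ∀ {m n} → (Fin m → Fin n) → Set
IsSurjective {m} {n} φ = ∀ (v : Fin n) → ∃[ x ] φ x ≡ v

_⪯_ : Digraph → Digraph → Set
A ⪯ B = Σ (Fin (size B) → Fin (size A)) λ φ → IsHom B A φ × IsSurjective φ

_⪯ₛ_ : Digraph → Digraph → Set
A ⪯ₛ B = Σ (Fin (size B) → Fin (size A)) λ φ →
  IsHom B A φ × IsStrong B A φ × IsSurjective φ

Class : Set₁
Class = Digraph → Set

_⊆𝒟I : Class → Set
𝒞 ⊆𝒟I = ∀ D → 𝒞 D → Irreflexive D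

DownwardClosed : (Digraph → Digraph → Set) → Class → Set
DownwardClosed _≤_ 𝒞 = ∀ A B → Irreflexive A → A ≤ B → 𝒞 B → 𝒞 A

_≅_ : Digraph → Digraph → Set
A ≅ B = Σ (Fin (size A) → Fin (size B)) λ f → Σ (Fin (size B) → Fin (size A)) λ g →
  (∀ x → g (f x) ≡ x) × (∀ y → f (g y) ≡ y) × (∀ x y → E B (f x) (f y) ≡ E A x y)

FiniteClass : Class → Set
FiniteClass 𝒞 = Σ (List Digraph) λ L → ∀ D → 𝒞 D → Any (D ≅_) L

InfiniteStrictlyDecreasing : (Digraph → Digraph → Set) → Class → Set
InfiniteStrictlyDecreasing _≤_ 𝒞 = Σ (ℕ → Digraph) λ s →
  (∀ i → 𝒞 (s i)) × (∀ i → (s (suc i) ≤ s i) × ¬ (s i ≤ s (suc i)))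

InfiniteAntichain : (Digraph → Digraph → Set) → Class → Set
InfiniteAntichain _≤_ 𝒞 = Σ (ℕ → Digraph) λ s →
  (∀ i → 𝒞 (s i)) × (∀ i j → i ≢ j → ¬ (s i ≤ s j))

WQO : (Digraph → Digraph → Set) → Class → Set
WQO _≤_ 𝒞 = ¬ InfiniteStrictlyDecreasing _≤_ 𝒞 × ¬ InfiniteAntichain _≤_ 𝒞

Av : (Digraph → Digraph → Set) → ∀ {k} → (Fin k → Digraph) → Class
Av _≤_ O D = Irreflexive D × (∀ i → ¬ (O i ≤ D))

-- The key observation is about semicomplete digraphs (any two distinct
-- vertices are joined by an edge in at least one direction): a homomorphism
-- from a semicomplete digraph onto an irreflexive one cannot identify two
-- vertices, so it is a bijection.  Hence irreflexive semicomplete digraphs of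
-- pairwise different sizes form an antichain under ⪯ (and so under ⪯ₛ).
--
-- (2) The transitive tournaments TT n with n larger than every obstruction
--     avoid all obstructions and form an infinite antichain.
-- (1) A finite class is wqo: by the pigeonhole principle any infinite
--     sequence repeats an isomorphism type, which rules out both infinite
--     antichains and infinite strictly decreasing chains.  Conversely (using
--     excluded middle) a class either has bounded size, and then it is finite
--     by an explicit enumeration of all digraphs of bounded size, or it has
--     members of every size; adding the edges of a linear order to them gives
--     semicomplete members (by downward closure) of increasing sizes, i.e. an
--     infinite antichain.
module Submission where

open import Defs
open import Level using (0ℓ)
open import Data.Nat using (ℕ; zero; suc; _+_; _≤_; _<_; _<ᵇ_; _<?_; z≤n; s≤s)
open import Data.Nat.Properties
  using (≤-trans; <-trans; ≤-antisym; <-cmp; <⇒≢; <-irrefl; ≮⇒≥; m≤m+n; m≤n+m;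
         n<1+n; m≤n⇒m<n∨m≡n; <ᵇ⇒<; <⇒<ᵇ)
open import Data.Fin using (Fin; toℕ) renaming (zero to fzero; suc to fsuc)
open import Data.Fin.Properties using (pigeonhole; injective⇒≤; toℕ-injective)
  renaming (_≟_ to _≟ᶠ_)
open import Data.Vec.Functional using () renaming (_∷_ to _∷ᶠ_)
open import Data.Bool using (Bool; true; false; T; _∨_)
open import Data.Bool.Properties using (T-∨)
open import Data.Product using (∃; ∃-syntax; _×_; _,_; proj₁; proj₂)
open import Data.Sum using (_⊎_; inj₁; inj₂)
open import Data.Empty using (⊥-elim)
open import Data.List using (List; []; _∷_; map; concatMap; cartesianProductWith; upTo; length; lookup)
open import Data.List.Relation.Unary.Any using (Any; here; there; index)
import Data.List.Relation.Unary.Any as Any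
open import Data.List.Relation.Unary.Any.Properties
  using (map⁺; concatMap⁺; cartesianProductWith⁺; lookup-index)
open import Data.List.Membership.Propositional using (lose)
open import Data.List.Membership.Propositional.Properties using (∈-upTo⁺)
open import Function.Bundles using (_⇔_; mk⇔; Equivalence)
open import Relation.Nullary using (¬_; yes; no)
open import Relation.Binary.PropositionalEquality
  using (_≡_; _≢_; refl; sym; trans; cong; cong₂; subst)
open import Relation.Binary.Definitions using (tri<; tri≈; tri>)
open import Axiom.ExcludedMiddle using (ExcludedMiddle)

⪯-refl : ∀ A → A ⪯ A
⪯-refl A = (λ x → x) , (λ x y e → e) , (λ v → v , refl)

⪯-trans : ∀ {A B C} → A ⪯ B → B ⪯ C → A ⪯ C
⪯-trans (φ , hom-φ , surj-φ) (ψ , hom-ψ , surj-ψ) =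
  (λ x → φ (ψ x)) ,
  (λ x y e → hom-φ (ψ x) (ψ y) (hom-ψ x y e)) ,
  λ v → let (b , φb≡v) = surj-φ v ; (c , ψc≡b) = surj-ψ b
        in c , trans (cong φ ψc≡b) φb≡v

≅⇒⪯ : ∀ {A B} → A ≅ B → B ⪯ A
≅⇒⪯ (f , g , _ , fg , preserves) =
  f , (λ x y e → subst T (sym (preserves x y)) e) , (λ y → g y , fg y)

≅-sym : ∀ {A B} → A ≅ B → B ≅ A
≅-sym {B = B} (f , g , gf , fg , preserves) =
  g , f , fg , gf ,
  λ u v → trans (sym (preserves (g u) (g v))) (cong₂ (E B) (fg u) (fg v))

≅-common⇒⪯ : ∀ {A B X} → A ≅ X → B ≅ X → A ⪯ B
≅-common⇒⪯ {A} {B} {X} A≅X B≅X =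
  ⪯-trans {A} {X} {B} (≅⇒⪯ {X} {A} (≅-sym {A} {X} A≅X)) (≅⇒⪯ {B} {X} B≅X)

⪯ₛ⇒⪯ : ∀ {A B} → A ⪯ₛ B → A ⪯ B
⪯ₛ⇒⪯ (φ , hom , _ , surj) = φ , hom , surj

-- A surjection Fin m → Fin n has a right inverse, which is injective.
surjective⇒≤ : ∀ {m n} (φ : Fin m → Fin n) → IsSurjective φ → n ≤ m
surjective⇒≤ φ surj = injective⇒≤ {f = λ v → proj₁ (surj v)}
  λ {u} {v} e → trans (sym (proj₂ (surj u))) (trans (cong φ e) (proj₂ (surj v)))

Semicomplete : Digraph → Set
Semicomplete D = ∀ x y → x ≢ y → Edge D x y ⊎ Edge D y x

-- A homomorphism from a semicomplete digraph into an irreflexive one is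
-- injective: identifying the ends of an edge would create a loop.
semicomplete-hom-injective : ∀ A B → Irreflexive A → Semicomplete B →
  (φ : Fin (size B) → Fin (size A)) → IsHom B A φ →
  ∀ {x y} → φ x ≡ φ y → x ≡ y
semicomplete-hom-injective A B irr semi φ hom {x} {y} φx≡φy with x ≟ᶠ y
... | yes x≡y = x≡y
... | no x≢y with semi x y x≢y
...   | inj₁ xy = ⊥-elim (irr (φ x) (subst (Edge A (φ x)) (sym φx≡φy) (hom x y xy)))
...   | inj₂ yx = ⊥-elim (irr (φ x) (subst (λ z → Edge A z (φ x)) (sym φx≡φy) (hom y x yx)))

semicomplete-image-size : ∀ A B → Irreflexive A → Semicomplete B →
  A ⪯ B → size A ≡ size B
semicomplete-image-size A B irr semi (φ , hom , surj) =
  ≤-antisym (surjective⇒≤ φ surj)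
            (injective⇒≤ (semicomplete-hom-injective A B irr semi φ hom))

stepwise-increasing⇒< : (f : ℕ → ℕ) → (∀ i → f i < f (suc i)) →
  ∀ i j → i < j → f i < f j
stepwise-increasing⇒< f step i (suc j) (s≤s i≤j) with m≤n⇒m<n∨m≡n i≤j
... | inj₁ i<j  = <-trans (stepwise-increasing⇒< f step i j i<j) (step j)
... | inj₂ refl = step i

stepwise-increasing⇒injective : (f : ℕ → ℕ) → (∀ i → f i < f (suc i)) →
  ∀ i j → f i ≡ f j → i ≡ j
stepwise-increasing⇒injective f step i j fi≡fj with <-cmp i j
... | tri< i<j _ _ = ⊥-elim (<⇒≢ (stepwise-increasing⇒< f step i j i<j) fi≡fj)
... | tri≈ _ i≡j _ = i≡j
... | tri> _ _ j<i = ⊥-elim (<⇒≢ (stepwise-increasing⇒< f step j i j<i) (sym fi≡fj))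

semicomplete-antichain : (s : ℕ → Digraph) → (∀ i → Irreflexive (s i)) →
  (∀ i → Semicomplete (s i)) → (∀ i → size (s i) < size (s (suc i))) →
  ∀ i j → i ≢ j → ¬ (s i ⪯ s j)
semicomplete-antichain s irr semi step i j i≢j si⪯sj =
  i≢j (stepwise-increasing⇒injective (λ n → size (s n)) step i j
        (semicomplete-image-size (s i) (s j) (irr i) (semi j) si⪯sj))

_⋖_ : ∀ {n} → Fin n → Fin n → Bool
x ⋖ y = toℕ x <ᵇ toℕ y

⋖-irreflexive : ∀ {n} (x : Fin n) → ¬ T (x ⋖ x)
⋖-irreflexive x x⋖x = <-irrefl refl (<ᵇ⇒< (toℕ x) (toℕ x) x⋖x)

⋖-connex : ∀ {n} (x y : Fin n) → x ≢ y → T (x ⋖ y) ⊎ T (y ⋖ x)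
⋖-connex x y x≢y with <-cmp (toℕ x) (toℕ y)
... | tri< x<y _ _ = inj₁ (<⇒<ᵇ x<y)
... | tri≈ _ x≡y _ = ⊥-elim (x≢y (toℕ-injective x≡y))
... | tri> _ _ y<x = inj₂ (<⇒<ᵇ y<x)

TT : ℕ → Digraph
TT n = mkDigraph n _⋖_

TT-irreflexive : ∀ n → Irreflexive (TT n)
TT-irreflexive n = ⋖-irreflexive

TT-semicomplete : ∀ n → Semicomplete (TT n)
TT-semicomplete n = ⋖-connex

completion : Digraph → Digraph
completion D = mkDigraph (size D) (λ x y → E D x y ∨ (x ⋖ y))

completion-irreflexive : ∀ D → Irreflexive D → Irreflexive (completion D)
completion-irreflexive D irr x loop with Equivalence.to T-∨ loop
... | inj₁ e   = irr x e
... | inj₂ x⋖x = ⋖-irreflexive x x⋖x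

completion-semicomplete : ∀ D → Semicomplete (completion D)
completion-semicomplete D x y x≢y with ⋖-connex x y x≢y
... | inj₁ x⋖y = inj₁ (Equivalence.from T-∨ (inj₂ x⋖y))
... | inj₂ y⋖x = inj₂ (Equivalence.from T-∨ (inj₂ y⋖x))

completion-⪯ : ∀ D → completion D ⪯ D
completion-⪯ D =
  (λ x → x) , (λ x y e → Equivalence.from T-∨ (inj₁ e)) , (λ v → v , refl)

upperBound : ∀ k → (Fin k → ℕ) → ℕ
upperBound zero    f = 0
upperBound (suc k) f = f fzero + upperBound k (λ i → f (fsuc i))

upperBound-≥ : ∀ k (f : Fin k → ℕ) i → f i ≤ upperBound k f
upperBound-≥ (suc k) f fzero    = m≤m+n (f fzero) _
upperBound-≥ (suc k) f (fsuc i) =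
  ≤-trans (upperBound-≥ k (λ j → f (fsuc j)) i) (m≤n+m _ (f fzero))

obstructions-not-wqo : ∀ (k : ℕ) (O : Fin k → Digraph) → (∀ i → Irreflexive (O i)) →
  ¬ WQO _⪯_ (Av _⪯_ O) × ¬ WQO _⪯ₛ_ (Av _⪯ₛ_ O)
obstructions-not-wqo k O irrO =
  (λ wqo → proj₂ wqo (tournaments , avoids⪯ , antichain)) ,
  (λ wqo → proj₂ wqo (tournaments , avoids⪯ₛ , λ i j i≢j p → antichain i j i≢j (⪯ₛ⇒⪯ p)))
  where
  tournaments : ℕ → Digraph
  tournaments i = TT (suc (i + upperBound k (λ j → size (O j))))

  -- an obstruction has fewer vertices than the tournament, so it is not an
  -- (irreflexive, hence equally large) image of it
  avoids : ∀ i j → ¬ (O j ⪯ tournaments i)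
  avoids i j Oj⪯T = <-irrefl (semicomplete-image-size (O j) (tournaments i)
                                (irrO j) (TT-semicomplete _) Oj⪯T)
                             (s≤s (≤-trans (upperBound-≥ k (λ j → size (O j)) j) (m≤n+m _ i)))

  avoids⪯ : ∀ i → Av _⪯_ O (tournaments i)
  avoids⪯ i = TT-irreflexive _ , avoids i

  avoids⪯ₛ : ∀ i → Av _⪯ₛ_ O (tournaments i)
  avoids⪯ₛ i = TT-irreflexive _ , λ j p → avoids i j (⪯ₛ⇒⪯ p)

  antichain : ∀ i j → i ≢ j → ¬ (tournaments i ⪯ tournaments j)
  antichain = semicomplete-antichain tournaments (λ _ → TT-irreflexive _)
                (λ _ → TT-semicomplete _) (λ _ → n<1+n _)

functions : ∀ {B : Set} (m : ℕ) → List B → List (Fin m → B)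
functions zero    L = (λ ()) ∷ []
functions (suc m) L = cartesianProductWith _∷ᶠ_ L (functions m L)

functions-complete : ∀ {B : Set} (R : B → B → Set) (L : List B) →
  (∀ b → Any (R b) L) →
  ∀ m (f : Fin m → B) → Any (λ g → ∀ x → R (f x) (g x)) (functions m L)
functions-complete R L covers zero    f = here (λ ())
functions-complete R L covers (suc m) f =
  cartesianProductWith⁺ _∷ᶠ_ extend (covers (f fzero))
    (functions-complete R L covers m (λ i → f (fsuc i)))
  where
  extend : ∀ {b g} → R (f fzero) b → (∀ x → R (f (fsuc x)) (g x)) →
           ∀ x → R (f x) ((b ∷ᶠ g) x)
  extend r rs fzero    = r
  extend r rs (fsuc x) = rs x

booleans-complete : ∀ b → Any (b ≡_) (true ∷ false ∷ [])
booleans-complete true  = here refl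
booleans-complete false = there (here refl)

relations : ∀ m → List (Fin m → Fin m → Bool)
relations m = functions m (functions m (true ∷ false ∷ []))

relations-complete : ∀ m (e : Fin m → Fin m → Bool) →
  Any (λ e′ → ∀ x y → e x y ≡ e′ x y) (relations m)
relations-complete m = functions-complete (λ r r′ → ∀ y → r y ≡ r′ y) _
  (functions-complete _≡_ _ booleans-complete m) m

pointwise⇒≅ : ∀ {m} {e e′ : Fin m → Fin m → Bool} → (∀ x y → e x y ≡ e′ x y) →
  mkDigraph m e ≅ mkDigraph m e′
pointwise⇒≅ e≗e′ = (λ x → x) , (λ x → x) , (λ _ → refl) , (λ _ → refl) ,
                   λ x y → sym (e≗e′ x y)

digraphsBelow : ℕ → List Digraph
digraphsBelow n = concatMap (λ m → map (mkDigraph m) (relations m)) (upTo n)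

digraphsBelow-complete : ∀ {n} D → size D < n → Any (D ≅_) (digraphsBelow n)
digraphsBelow-complete (mkDigraph m e) m<n =
  concatMap⁺ _ (lose (∈-upTo⁺ m<n)
    (map⁺ (Any.map pointwise⇒≅ (relations-complete m e))))

-- In a finite class every infinite sequence contains i < j with sᵢ ⪯ sⱼ,
-- since by pigeonhole two terms are isomorphic to the same listed digraph.
finite⇒good-pair : ∀ {𝒞} → FiniteClass 𝒞 → (s : ℕ → Digraph) → (∀ i → 𝒞 (s i)) →
  ∃[ i ] ∃[ j ] (i < j × s i ⪯ s j)
finite⇒good-pair (L , covers) s in𝒞
  with pigeonhole (n<1+n (length L)) (λ x → index (covers (s (toℕ x)) (in𝒞 (toℕ x))))
... | i , j , i<j , same-index =
  toℕ i , toℕ j , i<j ,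
  ≅-common⇒⪯ {s (toℕ i)} {s (toℕ j)} {lookup L (index (covers (s (toℕ i)) (in𝒞 (toℕ i))))}
    (lookup-index (covers (s (toℕ i)) (in𝒞 (toℕ i))))
    (subst (s (toℕ j) ≅_) (cong (lookup L) (sym same-index))
      (lookup-index (covers (s (toℕ j)) (in𝒞 (toℕ j)))))

descending⇒⪯ : (s : ℕ → Digraph) → (∀ i → s (suc i) ⪯ s i) → ∀ i j → i ≤ j → s j ⪯ s i
descending⇒⪯ s step zero zero z≤n = ⪯-refl (s zero)
descending⇒⪯ s step i (suc j) i≤1+j with m≤n⇒m<n∨m≡n i≤1+j
... | inj₁ (s≤s i≤j) = ⪯-trans {s (suc j)} {s j} {s i} (step j) (descending⇒⪯ s step i j i≤j)
... | inj₂ refl      = ⪯-refl (s i)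

finite⇒wqo : ∀ {𝒞} → FiniteClass 𝒞 → WQO _⪯_ 𝒞
finite⇒wqo {𝒞} fin = no-descending , no-antichain
  where
  no-descending : ¬ InfiniteStrictlyDecreasing _⪯_ 𝒞
  no-descending (s , in𝒞 , strict) with finite⇒good-pair {𝒞} fin s in𝒞
  ... | i , j , i<j , si⪯sj =
    proj₂ (strict i) (⪯-trans {s i} {s j} {s (suc i)} si⪯sj
      (descending⇒⪯ s (λ n → proj₁ (strict n)) (suc i) j i<j))

  no-antichain : ¬ InfiniteAntichain _⪯_ 𝒞
  no-antichain (s , in𝒞 , incomparable) with finite⇒good-pair {𝒞} fin s in𝒞
  ... | i , j , i<j , si⪯sj = incomparable i j (<⇒≢ i<j) si⪯sj

Bounded : Class → ℕ → Set
Bounded 𝒞 n = ∀ D → 𝒞 D → size D < n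

HasMemberOfSize≥ : Class → ℕ → Set
HasMemberOfSize≥ 𝒞 n = ∃[ D ] (𝒞 D × n ≤ size D)

Unbounded : Class → Set
Unbounded 𝒞 = ∀ n → HasMemberOfSize≥ 𝒞 n

bounded-or-unbounded : ExcludedMiddle 0ℓ → ∀ 𝒞 → (∃[ n ] Bounded 𝒞 n) ⊎ Unbounded 𝒞
bounded-or-unbounded em 𝒞 with em {∃[ n ] ¬ HasMemberOfSize≥ 𝒞 n}
... | yes (n , none) = inj₁ (n , λ D D∈𝒞 → small D D∈𝒞)
  where
  small : ∀ D → 𝒞 D → size D < n
  small D D∈𝒞 with size D <? n
  ... | yes D<n = D<n
  ... | no  D≮n = ⊥-elim (none (D , D∈𝒞 , ≮⇒≥ D≮n))
... | no no-bound = inj₂ λ n → witness n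
  where
  witness : ∀ n → HasMemberOfSize≥ 𝒞 n
  witness n with em {HasMemberOfSize≥ 𝒞 n}
  ... | yes found = found
  ... | no  none  = ⊥-elim (no-bound (n , none))

bounded⇒finite : ∀ {𝒞 n} → Bounded 𝒞 n → FiniteClass 𝒞
bounded⇒finite {n = n} bounded =
  digraphsBelow n , λ D D∈𝒞 → digraphsBelow-complete D (bounded D D∈𝒞)

unbounded⇒antichain : ∀ {𝒞} → 𝒞 ⊆𝒟I → DownwardClosed _⪯_ 𝒞 → Unbounded 𝒞 →
  InfiniteAntichain _⪯_ 𝒞
unbounded⇒antichain {𝒞} irr closed unbounded = completed , in𝒞 , antichain
  where
  growing : ℕ → ∃[ D ] (𝒞 D)
  growing zero    = let (D , D∈𝒞 , _) = unbounded 0 in D , D∈𝒞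
  growing (suc i) = let (D , D∈𝒞 , _) = unbounded (suc (size (proj₁ (growing i))))
                    in D , D∈𝒞

  grows : ∀ i → size (proj₁ (growing i)) < size (proj₁ (growing (suc i)))
  grows i = proj₂ (proj₂ (unbounded (suc (size (proj₁ (growing i))))))

  completed : ℕ → Digraph
  completed i = completion (proj₁ (growing i))

  completed-irreflexive : ∀ i → Irreflexive (completed i)
  completed-irreflexive i =
    completion-irreflexive (proj₁ (growing i)) (irr _ (proj₂ (growing i)))

  in𝒞 : ∀ i → 𝒞 (completed i)
  in𝒞 i = closed _ _ (completed-irreflexive i) (completion-⪯ _) (proj₂ (growing i))

  antichain : ∀ i j → i ≢ j → ¬ (completed i ⪯ completed j)
  antichain = semicomplete-antichain completed completed-irreflexive
                (λ i → completion-semicomplete _) grows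

downward-closed-wqo⇔finite : ExcludedMiddle 0ℓ → ∀ (𝒞 : Class) → 𝒞 ⊆𝒟I →
  DownwardClosed _⪯_ 𝒞 → (WQO _⪯_ 𝒞 ⇔ FiniteClass 𝒞)
downward-closed-wqo⇔finite em 𝒞 irr closed = mk⇔ wqo⇒finite finite⇒wqo
  where
  wqo⇒finite : WQO _⪯_ 𝒞 → FiniteClass 𝒞
  wqo⇒finite (_ , no-antichain) with bounded-or-unbounded em 𝒞
  ... | inj₁ (_ , bounded) = bounded⇒finite bounded
  ... | inj₂ unbounded     = ⊥-elim (no-antichain (unbounded⇒antichain irr closed unbounded))

theorem4p4 : (ExcludedMiddle 0ℓ → ∀ (𝒞 : Class) → 𝒞 ⊆𝒟I → DownwardClosed _⪯_ 𝒞 →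
    (WQO _⪯_ 𝒞 ⇔ FiniteClass 𝒞))
    × (∀ (k : ℕ) (O : Fin k → Digraph) → (∀ i → Irreflexive (O i)) →
    ¬ WQO _⪯_ (Av _⪯_ O) × ¬ WQO _⪯ₛ_ (Av _⪯ₛ_ O))
theorem4p4 = downward-closed-wqo⇔finite , obstructions-not-wqo
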